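{- Let $G$ be a connected graph of order $n$ with maximum degree $\Delta(G)=n-3$. Then every distance-balanced graph $H$ which contains $G$ as a spanning subgraph is regular.
   Context: All graphs are finite and simple. For vertices $u,v$ of a graph $H$, $d_H(u,v)$ is the length of a shortest $u$–$v$ path. For an edge $xy$ of $H$, $W^H_{xy}=\{u\in V(H): d_H(u,x)<d_H(u,y)\}$. A graph $H$ is distance-balanced if $|W^H_{xy}|=|W^H_{yx}|$ for every edge $xy$ of $H$. -}

module Defs where

open import Data.Nat using (ℕ; zero; suc; _+_; _≤_; _<ᵇ_)
open import Data.Bool using (Bool; true; false; _∧_; _∨_; if_then_else_)
open import Data.Fin using (Fin; _≟_)
open import Data.List using (List; allFin; map)
open import Data.Nat.ListAction using (sum)
open import Data.Bool.ListAction using (any)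
open import Data.Product using (Σ; ∃; _×_)
open import Relation.Nullary.Decidable using (⌊_⌋)
open import Relation.Binary.PropositionalEquality using (_≡_)

record Graph (n : ℕ) : Set where
  field
    adj   : Fin n → Fin n → Bool
    sym   : ∀ u v → adj u v ≡ adj v u
    irrefl : ∀ v → adj v v ≡ false
open Graph public

count : {n : ℕ} → (Fin n → Bool) → ℕ
count {n} p = sum (map (λ v → if p v then 1 else 0) (allFin n))

degree : {n : ℕ} → Graph n → Fin n → ℕ
degree G v = count (adj G v)

reach : {n : ℕ} → Graph n → ℕ → Fin n → Fin n → Bool
reach G zero    u v = ⌊ u ≟ v ⌋
reach G (suc k) u v = reach G k u v ∨ any (λ w → reach G k u w ∧ adj G w v) (allFin _)

firstReach : {n : ℕ} → Graph n → Fin n → Fin n → ℕ → ℕ → ℕ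
firstReach G u v k zero = k
firstReach G u v k (suc fuel) = if reach G k u v then k else firstReach G u v (suc k) fuel

-- d_G(u,v): length of a shortest u–v path (any shortest path has length < n;
-- if no path exists the value n is returned, which never matters below
-- because all graphs considered are connected)
dist : {n : ℕ} → Graph n → Fin n → Fin n → ℕ
dist {n} G u v = firstReach G u v 0 n

Connected : {n : ℕ} → Graph n → Set
Connected G = ∀ u v → ∃ λ k → reach G k u v ≡ true

Wsize : {n : ℕ} → Graph n → Fin n → Fin n → ℕ
Wsize H x y = count (λ u → dist H u x <ᵇ dist H u y)

DistanceBalanced : {n : ℕ} → Graph n → Set
DistanceBalanced H = ∀ x y → adj H x y ≡ true → Wsize H x y ≡ Wsize H y x

MaxDegree : {n : ℕ} → Graph n → ℕ → Set
MaxDegree G m = (∀ v → degree G v ≤ m) × (∃ λ v → degree G v ≡ m)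

SpanningSubgraph : {n : ℕ} → Graph n → Graph n → Set
SpanningSubgraph G H = ∀ u v → adj G u v ≡ true → adj H u v ≡ true

Regular : {n : ℕ} → Graph n → Set
Regular H = ∃ λ r → ∀ v → degree H v ≡ r

-- In a connected distance-balanced graph the transmission T(x) = Σ_u d(u,x) is constant:
-- for an edge xy, |W_xy| + T(x) = Σ_u max(d(u,x), d(u,y)) = |W_yx| + T(y).
-- Moreover 2 + deg x + T(x) = Σ_w max(2, d(w,x)) ≥ 2n, with equality when every vertex lies
-- within distance 2 of x. So if a vertex v of maximum degree D has eccentricity at most 2,
-- then deg u ≥ D for every u, and H is regular. Otherwise pick b at distance ≥ 3 from v.
-- Since D ≥ n − 3, v has at most two non-neighbours besides itself, so these are b and a
-- neighbour a of b, and connectivity forces a path v – x – a – b with deg b = 1. Comparing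
-- the sums at v (at most 2n + 1) and at b (at least 2n + 1) gives D ≤ deg b = 1 < 2 ≤ deg x.

module Submission where

open import Defs hiding (sym)
open Graph using () renaming (sym to adj-sym)
open import Algebra.Properties.CommutativeSemigroup using (interchange)
open import Data.Bool using (Bool; true; false; not; _∧_; _∨_; if_then_else_)
open import Data.Bool.Properties as Bool using (T-≡; ∨-zeroʳ; ∧-identityʳ; ¬-not)
open import Data.Bool.ListAction using (any)
open import Data.Empty using (⊥; ⊥-elim)
open import Data.Fin using (Fin; zero; suc; _≟_)
open import Data.Fin.Properties using (all?; any?; ¬∀⟶∃¬)
open import Data.List using (List; []; _∷_; map; allFin; length)
open import Data.List.Extrema.Nat using (argmax; f[xs]≤f[argmax])
open import Data.List.Membership.Propositional.Properties using (∈-allFin)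
open import Data.List.Properties using (map-cong; map-tabulate; length-tabulate)
open import Data.List.Relation.Unary.All as All using (All; []; _∷_)
open import Data.List.Relation.Unary.AllPairs using ([]; _∷_)
import Data.List.Relation.Unary.Any as Any
open import Data.List.Relation.Unary.Any.Properties using (any⁺; any⁻)
open import Data.List.Relation.Unary.Unique.Propositional using (Unique)
open import Data.Nat using (ℕ; zero; suc; _+_; _*_; _⊔_; _≤_; _<_; _<ᵇ_; z≤n; s≤s; z<s)
open import Data.Nat.ListAction using (sum)
open import Data.Nat.Properties hiding (_≟_)
open import Data.Product using (∃; _×_; _,_; proj₁; proj₂)
open import Data.Sum using (_⊎_; inj₁; inj₂)
open import Function using (_∘_; id; Equivalence)
open import Relation.Nullary using (¬_; yes; no; contradiction)
open import Relation.Nullary.Decidable using (⌊_⌋; _×-dec_)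
open import Relation.Nullary.Reflects using (ofʸ; ofⁿ)
open import Relation.Binary.PropositionalEquality

ι : Bool → ℕ
ι b = if b then 1 else 0

∑ : {n : ℕ} → (Fin n → ℕ) → ℕ
∑ {n} f = sum (map f (allFin n))

module _ {A : Set} where

  sum-map-+ : (f g : A → ℕ) (xs : List A) →
              sum (map (λ x → f x + g x) xs) ≡ sum (map f xs) + sum (map g xs)
  sum-map-+ f g []       = refl
  sum-map-+ f g (x ∷ xs) =
    trans (cong (f x + g x +_) (sum-map-+ f g xs))
          (interchange +-commutativeSemigroup (f x) (g x) _ _)

  sum-map-mono : {f g : A → ℕ} → (∀ x → f x ≤ g x) →
                 (xs : List A) → sum (map f xs) ≤ sum (map g xs)
  sum-map-mono f≤g []       = z≤n
  sum-map-mono f≤g (x ∷ xs) = +-mono-≤ (f≤g x) (sum-map-mono f≤g xs)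

  sum-map-const : (c : ℕ) (xs : List A) → sum (map (λ _ → c) xs) ≡ length xs * c
  sum-map-const c []       = refl
  sum-map-const c (x ∷ xs) = cong (c +_) (sum-map-const c xs)

module _ {n : ℕ} where

  ∑-cong : {f g : Fin n → ℕ} → (∀ i → f i ≡ g i) → ∑ f ≡ ∑ g
  ∑-cong f≗g = cong sum (map-cong f≗g (allFin n))

  ∑-+ : (f g : Fin n → ℕ) → ∑ (λ i → f i + g i) ≡ ∑ f + ∑ g
  ∑-+ f g = sum-map-+ f g (allFin n)

  ∑-mono : {f g : Fin n → ℕ} → (∀ i → f i ≤ g i) → ∑ f ≤ ∑ g
  ∑-mono f≤g = sum-map-mono f≤g (allFin n)

  ∑-const : (c : ℕ) → ∑ {n} (λ _ → c) ≡ n * c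
  ∑-const c = trans (sum-map-const c (allFin n)) (cong (_* c) (length-tabulate {n = n} id))

∑-suc : {n : ℕ} (f : Fin (suc n) → ℕ) → ∑ f ≡ f zero + ∑ (f ∘ suc)
∑-suc f = cong (λ xs → f zero + sum xs)
               (trans (map-tabulate suc f) (sym (map-tabulate id (f ∘ suc))))

count-≟ : {n : ℕ} (a : Fin n) → count (λ w → ⌊ w ≟ a ⌋) ≡ 1
count-≟ {suc n} zero    =
  trans (∑-suc (λ (w : Fin (suc n)) → ι ⌊ w ≟ zero ⌋))
        (cong suc (trans (∑-const {n} 0) (*-zeroʳ n)))
count-≟ {suc n} (suc a) =
  trans (∑-suc (λ w → ι ⌊ w ≟ suc a ⌋)) (trans (∑-cong (cong ι ∘ suc-≟-suc)) (count-≟ a))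
  where
  suc-≟-suc : ∀ w → ⌊ suc w ≟ suc a ⌋ ≡ ⌊ w ≟ a ⌋
  suc-≟-suc w with w ≟ a
  ... | yes _ = refl
  ... | no  _ = refl

∑-2+indicator : {n : ℕ} (a : Fin n) → ∑ (λ w → 2 + ι ⌊ w ≟ a ⌋) ≡ n * 2 + 1
∑-2+indicator {n} a =
  trans (∑-+ (λ _ → 2) (λ w → ι ⌊ w ≟ a ⌋)) (cong₂ _+_ (∑-const {n} 2) (count-≟ a))

module _ {n : ℕ} where

  count-mono : {p q : Fin n → Bool} → (∀ w → p w ≡ true → q w ≡ true) → count p ≤ count q
  count-mono {p} {q} p⇒q = ∑-mono ι-mono
    where
    ι-mono : ∀ w → ι (p w) ≤ ι (q w)
    ι-mono w with p w in pw
    ... | false = z≤n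
    ... | true rewrite p⇒q w pw = ≤-refl

  count-+-count-not : (p : Fin n → Bool) → count p + count (not ∘ p) ≡ n
  count-+-count-not p = begin
    count p + count (not ∘ p)          ≡⟨ ∑-+ (ι ∘ p) (ι ∘ not ∘ p) ⟨
    ∑ (λ w → ι (p w) + ι (not (p w)))  ≡⟨ ∑-cong {n} (λ w → ι-+-ι-not (p w)) ⟩
    ∑ {n} (λ _ → 1)                    ≡⟨ ∑-const {n} 1 ⟩
    n * 1                              ≡⟨ *-identityʳ n ⟩
    n                                  ∎
    where
    open ≡-Reasoning
    ι-+-ι-not : ∀ b → ι b + ι (not b) ≡ 1
    ι-+-ι-not true  = refl
    ι-+-ι-not false = refl

  count-remove : {p : Fin n → Bool} (a : Fin n) → p a ≡ true →
                 count p ≡ suc (count (λ w → p w ∧ not ⌊ w ≟ a ⌋))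
  count-remove {p} a pa = begin
    count p                                              ≡⟨ ∑-cong split ⟩
    ∑ (λ w → ι ⌊ w ≟ a ⌋ + ι (p w ∧ not ⌊ w ≟ a ⌋))      ≡⟨ ∑-+ {n} _ _ ⟩
    count (λ w → ⌊ w ≟ a ⌋) + count (λ w → p w ∧ not ⌊ w ≟ a ⌋)
      ≡⟨ cong (_+ count (λ w → p w ∧ not ⌊ w ≟ a ⌋)) (count-≟ a) ⟩
    suc (count (λ w → p w ∧ not ⌊ w ≟ a ⌋))              ∎
    where
    open ≡-Reasoning
    split : ∀ w → ι (p w) ≡ ι ⌊ w ≟ a ⌋ + ι (p w ∧ not ⌊ w ≟ a ⌋)
    split w with w ≟ a
    ... | yes refl rewrite pa = refl
    ... | no _     rewrite ∧-identityʳ (p w) = refl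

  distinct-≤-count : {p : Fin n → Bool} (ys : List (Fin n)) → Unique ys →
                     All (λ y → p y ≡ true) ys → length ys ≤ count p
  distinct-≤-count []       _              _          = z≤n
  distinct-≤-count {p} (y ∷ ys) (y∉ys ∷ uniq) (py ∷ pys) =
    subst (suc (length ys) ≤_) (sym (count-remove y py))
          (s≤s (distinct-≤-count ys uniq (All.zipWith keep (pys , y∉ys))))
    where
    keep : ∀ {w} → p w ≡ true × y ≢ w → (p w ∧ not ⌊ w ≟ y ⌋) ≡ true
    keep {w} (pw , y≢w) with w ≟ y
    ... | yes w≡y = contradiction (sym w≡y) y≢w
    ... | no _    = trans (∧-identityʳ (p w)) pw

any-allFin⁺ : {n : ℕ} (p : Fin n → Bool) (x : Fin n) → p x ≡ true → any p (allFin n) ≡ true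
any-allFin⁺ p x px = Equivalence.to T-≡
  (any⁺ {xs = allFin _} p (Any.map (λ { refl → Equivalence.from T-≡ px }) (∈-allFin x)))

any-allFin⁻ : {n : ℕ} (p : Fin n → Bool) → any p (allFin n) ≡ true → ∃ λ x → p x ≡ true
any-allFin⁻ {n} p anyp with Any.satisfied (any⁻ p (allFin n) (Equivalence.from T-≡ anyp))
... | x , px = x , Equivalence.to T-≡ px

module _ {n : ℕ} (K : Graph n) where

  reach-refl : ∀ u → reach K 0 u u ≡ true
  reach-refl u = cong ⌊_⌋ (≡-≟-identity _≟_ refl)

  reach-0⁻ : ∀ {u v} → reach K 0 u v ≡ true → u ≡ v
  reach-0⁻ {u} {v} r with u ≟ v
  ... | yes u≡v = u≡v

  reach-weaken : ∀ k {u v} → reach K k u v ≡ true → reach K (suc k) u v ≡ true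
  reach-weaken k r rewrite r = refl

  reach-step : ∀ k {u x y} → reach K k u x ≡ true → adj K x y ≡ true →
               reach K (suc k) u y ≡ true
  reach-step k {u} {x} {y} r x~y =
    trans (cong (reach K k u y ∨_)
                (any-allFin⁺ (λ w → reach K k u w ∧ adj K w y) x (cong₂ _∧_ r x~y)))
          (∨-zeroʳ (reach K k u y))

  reach-suc⁻ : ∀ k {u v} → reach K (suc k) u v ≡ true →
               reach K k u v ≡ true ⊎ ∃ λ z → reach K k u z ≡ true × adj K z v ≡ true
  reach-suc⁻ k {u} {v} r with reach K k u v in rk
  ... | true  = inj₁ refl
  ... | false with any-allFin⁻ (λ w → reach K k u w ∧ adj K w v) r
  ... | z , rz∧z~v with reach K k u z in rz | adj K z v in z~v
  ... | true  | true = inj₂ (z , rz , z~v)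
  ... | true  | false = contradiction rz∧z~v λ ()
  ... | false | _     = contradiction rz∧z~v λ ()

  reach-mono : ∀ {k j u v} → k ≤ j → reach K k u v ≡ true → reach K j u v ≡ true
  reach-mono {k} {j} k≤j r with m≤n⇒m<n∨m≡n k≤j
  ... | inj₂ refl              = r
  ... | inj₁ (s≤s {n = j′} k≤j′) = reach-weaken j′ (reach-mono k≤j′ r)

  reach-closed : (P : Fin n → Set) → (∀ {z w} → P z → adj K z w ≡ true → P w) →
                 ∀ k {u v} → P u → reach K k u v ≡ true → P v
  reach-closed P closed zero    pu r rewrite reach-0⁻ r = pu
  reach-closed P closed (suc k) pu r with reach-suc⁻ k r
  ... | inj₁ r′             = reach-closed P closed k pu r′
  ... | inj₂ (z , r′ , z~v) = closed (reach-closed P closed k pu r′) z~v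

  connected-closed : Connected K → (P : Fin n → Set) → (∀ {z w} → P z → adj K z w ≡ true → P w) →
                     ∀ {u v} → P u → P v
  connected-closed connected P closed {u} {v} pu =
    reach-closed P closed (proj₁ (connected u v)) pu (proj₂ (connected u v))

  reach-cons : ∀ k {w u v} → adj K w u ≡ true → reach K k u v ≡ true → reach K (suc k) w v ≡ true
  reach-cons zero    w~u r rewrite reach-0⁻ r = reach-step 0 (reach-refl _) w~u
  reach-cons (suc k) w~u r with reach-suc⁻ k r
  ... | inj₁ r′             = reach-weaken (suc k) (reach-cons k w~u r′)
  ... | inj₂ (z , r′ , z~v) = reach-step (suc k) (reach-cons k w~u r′) z~v

  reach-sym : ∀ k {u v} → reach K k u v ≡ true → reach K k v u ≡ true
  reach-sym zero    r rewrite reach-0⁻ r = reach-refl _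
  reach-sym (suc k) r with reach-suc⁻ k r
  ... | inj₁ r′             = reach-weaken k (reach-sym k r′)
  ... | inj₂ (z , r′ , z~v) = reach-cons k (trans (adj-sym K _ z) z~v) (reach-sym k r′)

  reach-1⁻ : ∀ {u v} → reach K 1 u v ≡ true → u ≡ v ⊎ adj K u v ≡ true
  reach-1⁻ r with reach-suc⁻ 0 r
  ... | inj₁ r′             = inj₁ (reach-0⁻ r′)
  ... | inj₂ (z , r′ , z~v) rewrite reach-0⁻ r′ = inj₂ z~v

  firstReach-≤ : ∀ u v k fuel → firstReach K u v k fuel ≤ k + fuel
  firstReach-≤ u v k zero = m≤m+n k 0
  firstReach-≤ u v k (suc fuel) with reach K k u v
  ... | true  = m≤m+n k (suc fuel)
  ... | false = subst (firstReach K u v (suc k) fuel ≤_) (sym (+-suc k fuel))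
                      (firstReach-≤ u v (suc k) fuel)

  firstReach-least : ∀ u v k fuel {j} → reach K j u v ≡ true → k ≤ j → firstReach K u v k fuel ≤ j
  firstReach-least u v k zero       r k≤j = k≤j
  firstReach-least u v k (suc fuel) r k≤j with reach K k u v in rk
  ... | true  = k≤j
  ... | false = firstReach-least u v (suc k) fuel r
                  (≤∧≢⇒< k≤j λ { refl → contradiction (trans (sym r) rk) λ () })

  firstReach-reaches : ∀ u v k fuel → firstReach K u v k fuel < k + fuel →
                       reach K (firstReach K u v k fuel) u v ≡ true
  firstReach-reaches u v k zero       lt = contradiction (sym (+-identityʳ k)) (<⇒≢ lt)
  firstReach-reaches u v k (suc fuel) lt with reach K k u v in rk
  ... | true  = rk
  ... | false = firstReach-reaches u v (suc k) fuel
                  (subst (firstReach K u v (suc k) fuel <_) (+-suc k fuel) lt)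

  reach⇒dist≤ : ∀ {j u v} → reach K j u v ≡ true → dist K u v ≤ j
  reach⇒dist≤ {u = u} {v} r = firstReach-least u v 0 n r z≤n

  dist≤⇒reach : ∀ {j u v} → j < n → dist K u v ≤ j → reach K j u v ≡ true
  dist≤⇒reach {u = u} {v} j<n d≤j = reach-mono d≤j (firstReach-reaches u v 0 n (≤-<-trans d≤j j<n))

  dist-step : ∀ u {x y} → adj K x y ≡ true → dist K u y ≤ suc (dist K u x)
  dist-step u {x} {y} x~y with m≤n⇒m<n∨m≡n (firstReach-≤ u x 0 n)
  ... | inj₁ d<n = reach⇒dist≤ (reach-step (dist K u x) (firstReach-reaches u x 0 n d<n) x~y)
  ... | inj₂ d≡n = ≤-trans (firstReach-≤ u y 0 n) (≤-trans (≤-reflexive (sym d≡n)) (n≤1+n _))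

  dist-self : ∀ u → dist K u u ≡ 0
  dist-self u = n≤0⇒n≡0 (reach⇒dist≤ (reach-refl u))

  module _ (1<n : 1 < n) {w u : Fin n} (w≢u : w ≢ u) where

    dist-adjacent : adj K w u ≡ true → dist K w u ≡ 1
    dist-adjacent w~u = ≤-antisym (reach⇒dist≤ (reach-step 0 (reach-refl w) w~u)) (≰⇒> d≰0)
      where
      d≰0 : ¬ dist K w u ≤ 0
      d≰0 d≤0 = w≢u (reach-0⁻ (dist≤⇒reach (<-trans z<s 1<n) d≤0))

    dist-nonadjacent : adj K w u ≡ false → 2 ≤ dist K w u
    dist-nonadjacent w≁u = ≰⇒> d≰1
      where
      d≰1 : ¬ dist K w u ≤ 1
      d≰1 d≤1 with reach-1⁻ (dist≤⇒reach 1<n d≤1)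
      ... | inj₁ w≡u = w≢u w≡u
      ... | inj₂ w~u = contradiction (trans (sym w~u) w≁u) λ ()

transmission : {n : ℕ} → Graph n → Fin n → ℕ
transmission K x = ∑ (λ u → dist K u x)

profile : {n : ℕ} → Graph n → Fin n → ℕ
profile K x = ∑ (λ w → 2 ⊔ dist K w x)

module _ {n : ℕ} (K : Graph n) (1<n : 1 < n) where

  2⊔dist-split : ∀ u w →
    ι ⌊ w ≟ u ⌋ + ι ⌊ w ≟ u ⌋ + ι (adj K u w) + dist K w u ≡ 2 ⊔ dist K w u
  2⊔dist-split u w with w ≟ u
  ... | yes refl rewrite dist-self K u | irrefl K u = refl
  ... | no w≢u with adj K u w in u~w
  ... | true  rewrite dist-adjacent K 1<n w≢u (trans (adj-sym K w u) u~w) = refl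
  ... | false = sym (m≤n⇒m⊔n≡n (dist-nonadjacent K 1<n w≢u (trans (adj-sym K w u) u~w)))

  degree-+-transmission : ∀ u → 2 + degree K u + transmission K u ≡ profile K u
  degree-+-transmission u = begin
    2 + degree K u + transmission K u
      ≡⟨ cong₂ (λ s t → s + t + ∑ a + ∑ d) (count-≟ u) (count-≟ u) ⟨
    ∑ e + ∑ e + ∑ a + ∑ d                  ≡⟨ cong (λ s → s + ∑ a + ∑ d) (∑-+ e e) ⟨
    ∑ (λ w → e w + e w) + ∑ a + ∑ d        ≡⟨ cong (_+ ∑ d) (∑-+ (λ w → e w + e w) a) ⟨
    ∑ (λ w → e w + e w + a w) + ∑ d        ≡⟨ ∑-+ (λ w → e w + e w + a w) d ⟨
    ∑ (λ w → e w + e w + a w + d w)        ≡⟨ ∑-cong (2⊔dist-split u) ⟩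
    profile K u                            ∎
    where
    open ≡-Reasoning
    e a d : Fin n → ℕ
    e w = ι ⌊ w ≟ u ⌋
    a w = ι (adj K u w)
    d w = dist K w u

profile-≥ : {n : ℕ} (K : Graph n) → ∀ u → n * 2 ≤ profile K u
profile-≥ {n} K u = subst (_≤ profile K u) (∑-const {n} 2) (∑-mono (λ w → m≤m⊔n 2 (dist K w u)))

ι<ᵇ+≡⊔ : ∀ a b → b ≤ suc a → ι (a <ᵇ b) + a ≡ a ⊔ b
ι<ᵇ+≡⊔ a b b≤1+a with a <ᵇ b | <ᵇ-reflects-< a b
... | true  | ofʸ a<b = sym (trans (m≤n⇒m⊔n≡n (<⇒≤ a<b)) (≤-antisym b≤1+a a<b))
... | false | ofⁿ a≮b = sym (m≥n⇒m⊔n≡m (≮⇒≥ a≮b))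

module _ {n : ℕ} (H : Graph n) where

  Wsize-+-transmission : ∀ {x y} → adj H x y ≡ true →
                         Wsize H x y + transmission H x ≡ ∑ (λ u → dist H u x ⊔ dist H u y)
  Wsize-+-transmission {x} {y} x~y =
    trans (sym (∑-+ (λ u → ι (dist H u x <ᵇ dist H u y)) (λ u → dist H u x)))
          (∑-cong λ u → ι<ᵇ+≡⊔ _ _ (dist-step H u x~y))

  transmission-adjacent : DistanceBalanced H → ∀ {x y} → adj H x y ≡ true →
                          transmission H x ≡ transmission H y
  transmission-adjacent balanced {x} {y} x~y = +-cancelˡ-≡ (Wsize H x y) _ _ (begin
    Wsize H x y + transmission H x             ≡⟨ Wsize-+-transmission x~y ⟩
    ∑ (λ u → dist H u x ⊔ dist H u y)          ≡⟨ ∑-cong (λ u → ⊔-comm (dist H u x) _) ⟩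
    ∑ (λ u → dist H u y ⊔ dist H u x)          ≡⟨ Wsize-+-transmission (trans (adj-sym H y x) x~y) ⟨
    Wsize H y x + transmission H y             ≡⟨ cong (_+ transmission H y) (balanced x y x~y) ⟨
    Wsize H x y + transmission H y             ∎)
    where open ≡-Reasoning

  transmission-constant : DistanceBalanced H → Connected H →
                          ∀ u w → transmission H u ≡ transmission H w
  transmission-constant balanced connected u w =
    connected-closed H connected (λ z → transmission H u ≡ transmission H z)
                     (λ Tu≡Tz z~w → trans Tu≡Tz (transmission-adjacent balanced z~w)) refl

module _ {n : ℕ} (G H : Graph n) (G⊆H : SpanningSubgraph G H) where

  reach-⊆ : ∀ k {u v} → reach G k u v ≡ true → reach H k u v ≡ true
  reach-⊆ zero    r = r
  reach-⊆ (suc k) r with reach-suc⁻ G k r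
  ... | inj₁ r′             = reach-weaken H k (reach-⊆ k r′)
  ... | inj₂ (z , r′ , z~v) = reach-step H k (reach-⊆ k r′) (G⊆H _ _ z~v)

  connected-⊆ : Connected G → Connected H
  connected-⊆ connected u v with connected u v
  ... | k , r = k , reach-⊆ k r

  degree-⊆ : ∀ u → degree G u ≤ degree H u
  degree-⊆ u = count-mono (G⊆H u)

module _ {n : ℕ} (H : Graph n) (2<n : 2 < n)
         (balanced : DistanceBalanced H) (connected : Connected H) where

  private
    1<n : 1 < n
    1<n = <-trans (n<1+n 1) 2<n

  profile-≤⇒degree-≤ : ∀ {u w} → profile H u ≤ profile H w → degree H u ≤ degree H w
  profile-≤⇒degree-≤ {u} {w} Pu≤Pw =
    +-cancelˡ-≤ 2 _ _ (+-cancelʳ-≤ (transmission H u) _ _ (begin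
      2 + degree H u + transmission H u  ≡⟨ degree-+-transmission H 1<n u ⟩
      profile H u                        ≤⟨ Pu≤Pw ⟩
      profile H w                        ≡⟨ degree-+-transmission H 1<n w ⟨
      2 + degree H w + transmission H w  ≡⟨ cong (2 + degree H w +_) (Tw≡Tu) ⟩
      2 + degree H w + transmission H u  ∎))
    where
    open ≤-Reasoning
    Tw≡Tu : transmission H w ≡ transmission H u
    Tw≡Tu = transmission-constant H balanced connected w u

  module _ (v : Fin n) (v-max : ∀ u → degree H u ≤ degree H v) where

    eccentricity≤2⇒regular : (∀ w → reach H 2 w v ≡ true) → ∀ u → degree H u ≡ degree H v
    eccentricity≤2⇒regular near u =
      ≤-antisym (v-max u) (profile-≤⇒degree-≤ (≤-trans profile-v≤ (profile-≥ H u)))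
      where
      profile-v≤ : profile H v ≤ n * 2
      profile-v≤ = subst (profile H v ≤_) (∑-const {n} 2)
                         (∑-mono λ w → ⊔-lub ≤-refl (reach⇒dist≤ H (near w)))

    module _ (few-non-neighbours : n ≤ degree H v + 3) where

      non-neighbours≤3 : count (not ∘ adj H v) ≤ 3
      non-neighbours≤3 = +-cancelˡ-≤ (degree H v) _ _
        (subst (_≤ degree H v + 3) (sym (count-+-count-not (adj H v))) few-non-neighbours)

      module _ (b : Fin n) (b-far : reach H 2 b v ≡ false) where

        not-near : ∀ {k} → k ≤ 2 → reach H k b v ≡ true → ⊥
        not-near k≤2 r = contradiction (trans (sym (reach-mono H k≤2 r)) b-far) λ ()

        b≢v : b ≢ v
        b≢v refl = not-near z≤n (reach-refl H b)

        b≁v : adj H b v ≡ false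
        b≁v = ¬-not {y = true} λ b~v → not-near (s≤s z≤n) (reach-step H 0 (reach-refl H b) b~v)

        v≁b : adj H v b ≡ false
        v≁b = trans (adj-sym H v b) b≁v

        neighbour-of-b-≁v : ∀ {z} → adj H b z ≡ true → adj H v z ≡ false
        neighbour-of-b-≁v {z} b~z = ¬-not {y = true} λ v~z →
          not-near ≤-refl (reach-step H 1 (reach-step H 0 (reach-refl H b) b~z)
                                          (trans (adj-sym H z v) v~z))

        b-has-neighbour : ∃ λ a → adj H b a ≡ true
        b-has-neighbour with any? (λ a → adj H b a Bool.≟ true)
        ... | yes b~a  = b~a
        ... | no  b≁any = contradiction
          (connected-closed H connected (_≡ b) stays refl) (≢-sym b≢v)
          where
          stays : ∀ {z w} → z ≡ b → adj H z w ≡ true → w ≡ b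
          stays refl b~w = contradiction (_ , b~w) b≁any

        module _ (a : Fin n) (b~a : adj H b a ≡ true) where

          a≢v : a ≢ v
          a≢v refl = contradiction (trans (sym b~a) b≁v) λ ()

          a≢b : a ≢ b
          a≢b refl = contradiction (trans (sym b~a) (irrefl H a)) λ ()

          v≁a : adj H v a ≡ false
          v≁a = neighbour-of-b-≁v b~a

          far-⊆ : ∀ {w} → w ≢ v → adj H v w ≡ false → w ≡ a ⊎ w ≡ b
          far-⊆ {w} w≢v v≁w with w ≟ a | w ≟ b
          ... | yes w≡a | _       = inj₁ w≡a
          ... | no _    | yes w≡b = inj₂ w≡b
          ... | no w≢a  | no w≢b  =
            contradiction (≤-trans (distinct-≤-count (v ∷ a ∷ b ∷ w ∷ []) distinct far)
                                   non-neighbours≤3)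
                          λ { (s≤s (s≤s (s≤s ()))) }
            where
            distinct : Unique (v ∷ a ∷ b ∷ w ∷ [])
            distinct = (≢-sym a≢v ∷ ≢-sym b≢v ∷ ≢-sym w≢v ∷ []) ∷ (a≢b ∷ ≢-sym w≢a ∷ [])
                     ∷ (≢-sym w≢b ∷ []) ∷ [] ∷ []
            far : All (λ y → not (adj H v y) ≡ true) (v ∷ a ∷ b ∷ w ∷ [])
            far = cong not (irrefl H v) ∷ cong not v≁a ∷ cong not v≁b ∷ cong not v≁w ∷ []

          neighbour-of-b : ∀ {w} → adj H b w ≡ true → w ≡ a
          neighbour-of-b {w} b~w with far-⊆ w≢v (neighbour-of-b-≁v b~w)
            where
            w≢v : w ≢ v
            w≢v refl = contradiction (trans (sym b~w) b≁v) λ ()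
          ... | inj₁ w≡a = w≡a
          ... | inj₂ refl = contradiction (trans (sym b~w) (irrefl H b)) λ ()

          degree-b≤1 : degree H b ≤ 1
          degree-b≤1 = ≤-trans (count-mono {q = λ w → ⌊ w ≟ a ⌋} b~w⇒w≡a) (≤-reflexive (count-≟ a))
            where
            b~w⇒w≡a : ∀ w → adj H b w ≡ true → ⌊ w ≟ a ⌋ ≡ true
            b~w⇒w≡a w b~w = cong ⌊_⌋ (≡-≟-identity _≟_ (neighbour-of-b b~w))

          a-has-neighbour-adjacent-to-v : ∃ λ x → adj H a x ≡ true × adj H x v ≡ true
          a-has-neighbour-adjacent-to-v
            with any? (λ x → (adj H a x Bool.≟ true) ×-dec (adj H x v Bool.≟ true))
          ... | yes path = path
          ... | no  ¬path
            with connected-closed H connected (λ w → w ≡ a ⊎ w ≡ b) stays {b} {v} (inj₂ refl)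
            where
            stays : ∀ {z w} → z ≡ a ⊎ z ≡ b → adj H z w ≡ true → w ≡ a ⊎ w ≡ b
            stays (inj₂ refl) b~w = inj₁ (neighbour-of-b b~w)
            stays {w = w} (inj₁ refl) a~w = far-⊆ w≢v (¬-not {y = true} λ v~w →
              ¬path (w , a~w , trans (adj-sym H w v) v~w))
              where
              w≢v : w ≢ v
              w≢v refl = contradiction (trans (sym a~w) (trans (adj-sym H a v) v≁a)) λ ()
          ... | inj₁ v≡a = contradiction (sym v≡a) a≢v
          ... | inj₂ v≡b = contradiction (sym v≡b) b≢v

          module _ (x : Fin n) (a~x : adj H a x ≡ true) (x~v : adj H x v ≡ true) where

            a-near : reach H 2 a v ≡ true
            a-near = reach-step H 1 (reach-step H 0 (reach-refl H a) a~x) x~v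

            near-except-b : ∀ w → w ≢ b → reach H 2 w v ≡ true
            near-except-b w w≢b with v ≟ w
            ... | yes refl = reach-mono H {0} {2} z≤n (reach-refl H w)
            ... | no v≢w with adj H v w in v~w
            ... | true  = reach-weaken H 1 (reach-step H 0 (reach-refl H w)
                                                         (trans (adj-sym H w v) v~w))
            ... | false with far-⊆ (≢-sym v≢w) v~w
            ... | inj₁ refl = a-near
            ... | inj₂ w≡b  = contradiction w≡b w≢b

            profile-v≤ : profile H v ≤ n * 2 + 1
            profile-v≤ = subst (profile H v ≤_) (∑-2+indicator b) (∑-mono bound)
              where
              bound : ∀ w → 2 ⊔ dist H w v ≤ 2 + ι ⌊ w ≟ b ⌋
              bound w with w ≟ b
              ... | yes refl = ⊔-lub (n≤1+n 2) (reach⇒dist≤ H (reach-cons H 2 b~a a-near))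
              ... | no w≢b   = ⊔-lub ≤-refl (reach⇒dist≤ H (near-except-b w w≢b))

            profile-b≥ : n * 2 + 1 ≤ profile H b
            profile-b≥ = subst (_≤ profile H b) (∑-2+indicator v) (∑-mono bound)
              where
              dist-v-b≥3 : 3 ≤ dist H v b
              dist-v-b≥3 = ≰⇒> λ d≤2 → not-near ≤-refl (reach-sym H 2 (dist≤⇒reach H 2<n d≤2))
              bound : ∀ w → 2 + ι ⌊ w ≟ v ⌋ ≤ 2 ⊔ dist H w b
              bound w with w ≟ v
              ... | yes refl = ≤-trans dist-v-b≥3 (m≤n⊔m 2 (dist H v b))
              ... | no _     = m≤m⊔n 2 (dist H w b)

            degree-x≥2 : 2 ≤ degree H x
            degree-x≥2 = distinct-≤-count (v ∷ a ∷ []) ((≢-sym a≢v ∷ []) ∷ [] ∷ [])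
                                          (x~v ∷ trans (adj-sym H x a) a~x ∷ [])

            path-to-far-vertex⇒⊥ : ⊥
            path-to-far-vertex⇒⊥ = contradiction (begin
              2            ≤⟨ degree-x≥2 ⟩
              degree H x   ≤⟨ v-max x ⟩
              degree H v   ≤⟨ profile-≤⇒degree-≤ (≤-trans profile-v≤ profile-b≥) ⟩
              degree H b   ≤⟨ degree-b≤1 ⟩
              1            ∎) λ { (s≤s ()) }
              where open ≤-Reasoning

        far-vertex⇒⊥ : ⊥
        far-vertex⇒⊥ with b-has-neighbour
        ... | a , b~a with a-has-neighbour-adjacent-to-v a b~a
        ... | x , a~x , x~v = path-to-far-vertex⇒⊥ a b~a x a~x x~v

      max-degree≥n∸3⇒regular : Regular H
      max-degree≥n∸3⇒regular with all? (λ w → reach H 2 w v Bool.≟ true)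
      ... | yes near = degree H v , eccentricity≤2⇒regular near
      ... | no ¬near with ¬∀⟶∃¬ n _ (λ w → reach H 2 w v Bool.≟ true) ¬near
      ... | b , b-not-near = ⊥-elim (far-vertex⇒⊥ b (¬-not {y = true} b-not-near))

corollary4p5 : (n : ℕ) (G : Graph n) (Δ : ℕ) → Connected G → MaxDegree G Δ → Δ + 3 ≡ n →
                 (H : Graph n) → SpanningSubgraph G H → DistanceBalanced H → Regular H
corollary4p5 n G Δ G-connected (_ , v₀ , deg-v₀≡Δ) Δ+3≡n H G⊆H balanced =
  max-degree≥n∸3⇒regular H 2<n balanced (connected-⊆ G H G⊆H G-connected) v v-max few-non-neighbours
  where
  2<n : 2 < n
  2<n = subst (2 <_) Δ+3≡n (m≤n+m 3 Δ)

  v : Fin n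
  v = argmax (degree H) v₀ (allFin n)

  v-max : ∀ u → degree H u ≤ degree H v
  v-max u = All.lookup (f[xs]≤f[argmax] v₀ (allFin n)) (∈-allFin u)

  few-non-neighbours : n ≤ degree H v + 3
  few-non-neighbours = begin
    n                 ≡⟨ Δ+3≡n ⟨
    Δ + 3             ≡⟨ cong (_+ 3) deg-v₀≡Δ ⟨
    degree G v₀ + 3   ≤⟨ +-monoˡ-≤ 3 (≤-trans (degree-⊆ G H G⊆H v₀) (v-max v₀)) ⟩
    degree H v + 3    ∎
    where open ≤-Reasoning
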